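{- Let $n\ge1$. The map sending a positive integral frieze $F$ on the annulus $A_{n,n}$ to the family $u_{i,j}=F(\gamma_{i,j})$, $i,j\in\mathbb Z$, is a bijection between positive integral friezes on $A_{n,n}$ and positive integral $n$-periodic bi-infinite quasi-friezes.
   Context: A bi-infinite quasi-frieze (BiQF) is a family $(u_{i,j})_{i,j\in\mathbb Z}$ of real numbers (arranged in a diamond grid) satisfying the quasi-diamond rule $u_{i,j}u_{i+1,j+1}-u_{i,j+1}u_{i+1,j}=-1$ for all $i,j$. It is positive integral if all entries are positive integers, and $n$-periodic if $u_{i+n,j+n}=u_{i,j}$ for all $i,j$. $A_{n,n}$ is an annulus with marked points $P_1,\dots,P_n$ on one boundary component and $Q_1,\dots,Q_n$ on the other. An arc is a non-contractible simple curve with endpoints at marked points, up to isotopy; boundary segments between consecutive marked points are arcs too. A quadrilateral $ABCD$ is a collection of pairwise non-crossing arcs $AB,BC,CD,DA$ cutting out a disc with vertices in this cyclic order. A positive integral frieze on $A_{n,n}$ assigns a positive integer $F(\gamma)$ to every arc, with $F=1$ on boundary segments and $F(AC)F(BD)=F(AB)F(CD)+F(BC)F(AD)$ for all quadrilaterals $ABCD$. In the universal cover (an infinite strip) marked points lift to $\hat P_i$, $\hat Q_j$ ($i,j\in\mathbb Z$) on the two boundary lines, $\hat P_i$ over $P_{i'}$ with $i'\equiv i\pmod n$, $\hat Q_j$ over $Q_{j'}$ with $j'\equiv j\pmod n$, deck generator $\hat P_i\mapsto\hat P_{i+n}$, $\hat Q_j\mapsto\hat Q_{j+n}$, labels chosen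 so that $\hat P_i,\hat P_{i+1},\hat Q_{j+1},\hat Q_j$ form a quadrilateral in this cyclic order. $\gamma_{i,j}$ is the bridging arc that is the image of the segment $\hat P_i\hat Q_j$. -}

module Defs where

open import Data.Bool using (Bool; true; T; _∧_)
open import Data.Nat as ℕ using (ℕ)
open import Data.Integer using (ℤ; +_; _+_; _-_; _*_; _<_; ∣_∣; 0ℤ; 1ℤ; -1ℤ)
open import Data.Unit using (⊤)
open import Data.Empty using (⊥)
open import Data.Product using (_×_; ∃)
open import Data.Sum using (_⊎_)
open import Relation.Binary.PropositionalEquality using (_≡_; _≢_)

-- Combinatorial model of the annulus A_{n,n} via its universal cover.
-- The universal cover is an infinite strip; lifted marked points are
-- P̂ i on one boundary line and Q̂ j on the other (i j : ℤ).

data Pt : Set where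
  P : ℤ → Pt
  Q : ℤ → Pt

-- Deck transformation by k steps: P̂ i ↦ P̂ (i+k), Q̂ j ↦ Q̂ (j+k).
-- The deck group of A_{n,n} is generated by shift (+ n).
shift : ℤ → Pt → Pt
shift k (P i) = P (i + k)
shift k (Q j) = Q (j + k)

-- Linear order along the boundary of the strip, cut at the end -∞:
-- P̂'s in increasing order, then Q̂'s in decreasing order.  Read
-- cyclically this is the cyclic order of the boundary of the strip
-- (viewed as a disc), so that P̂ i, P̂ (i+1), Q̂ (j+1), Q̂ j are in
-- cyclic order, as in the paper's labelling convention.
data _<ᵖ_ : Pt → Pt → Set where
  PP : ∀ {i k} → i < k → P i <ᵖ P k
  PQ : ∀ {i j} → P i <ᵖ Q j
  QQ : ∀ {j l} → l < j → Q j <ᵖ Q l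

_≤ᵖ_ : Pt → Pt → Set
a ≤ᵖ b = a <ᵖ b ⊎ a ≡ b

-- A lifted segment a b projects to an arc of A_{n,n}
-- (a simple, non-contractible curve): bridging arcs always; peripheral
-- arcs P̂ i P̂ k iff 1 ≤ |k - i| ≤ n (similarly for Q̂).
isArc : ℕ → Pt → Pt → Bool
isArc n (P i) (P k) = (1 ℕ.≤ᵇ ∣ k - i ∣) ∧ (∣ k - i ∣ ℕ.≤ᵇ n)
isArc n (Q j) (Q l) = (1 ℕ.≤ᵇ ∣ l - j ∣) ∧ (∣ l - j ∣ ℕ.≤ᵇ n)
isArc n (P i) (Q j) = true
isArc n (Q j) (P i) = true

IsArc : ℕ → Pt → Pt → Set
IsArc n a b = T (isArc n a b)

-- Boundary segments: lifts of segments between consecutive marked points.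
IsBoundarySeg : Pt → Pt → Set
IsBoundarySeg (P i) (P k) = ∣ k - i ∣ ≡ 1
IsBoundarySeg (Q j) (Q l) = ∣ l - j ∣ ≡ 1
IsBoundarySeg (P i) (Q j) = ⊥
IsBoundarySeg (Q j) (P i) = ⊥

Cyc : Pt → Pt → Pt → Pt → Set
Cyc a b c d =
    (a <ᵖ b × b <ᵖ c × c <ᵖ d)
  ⊎ (b <ᵖ c × c <ᵖ d × d <ᵖ a)
  ⊎ (c <ᵖ d × d <ᵖ a × a <ᵖ b)
  ⊎ (d <ᵖ a × a <ᵖ b × b <ᵖ c)

InArc : Pt → Pt → Pt → Set
InArc a b x = (a ≤ᵖ x × x ≤ᵖ b) ⊎ (b <ᵖ a × (a ≤ᵖ x ⊎ x ≤ᵖ b))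

-- For a b c d in increasing cyclic order: the quadrilateral they span
-- in the cover projects injectively (on its interior) to the annulus,
-- i.e. it has disjoint interior from each nontrivial deck translate:
-- all vertices of the translate lie in one closed boundary arc between
-- two consecutive vertices.
AllShifted : ℤ → (Pt → Set) → Pt → Pt → Pt → Pt → Set
AllShifted k R a b c d =
  R (shift k a) × R (shift k b) × R (shift k c) × R (shift k d)

Emb : ℕ → Pt → Pt → Pt → Pt → Set
Emb n a b c d = ∀ (k : ℤ) → k ≢ 0ℤ →
    AllShifted (k * + n) (InArc a b) a b c d
  ⊎ AllShifted (k * + n) (InArc b c) a b c d
  ⊎ AllShifted (k * + n) (InArc c d) a b c d
  ⊎ AllShifted (k * + n) (InArc d a) a b c d

-- A, B, C, D are (lifts of) the vertices, in this cyclic order (either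
-- orientation), of a quadrilateral of A_{n,n}.  (That the sides AB, BC,
-- CD, DA are arcs is required separately where Quad is used.)
Quad : ℕ → Pt → Pt → Pt → Pt → Set
Quad n A B C D = (Cyc A B C D × Emb n A B C D) ⊎ (Cyc D C B A × Emb n D C B A)

-- Positive integral friezes on A_{n,n}: functions on arcs of the annulus,
-- modelled as functions on lifted arcs that are symmetric and invariant
-- under the deck group.

record Frieze (n : ℕ) : Set where
  field
    F        : (a b : Pt) → IsArc n a b → ℤ
    positive : ∀ a b (p : IsArc n a b) → 0ℤ < F a b p
    symm     : ∀ a b (p : IsArc n a b) (q : IsArc n b a) → F a b p ≡ F b a q
    deck     : ∀ (k : ℤ) a b (p : IsArc n a b)
                 (q : IsArc n (shift (k * + n) a) (shift (k * + n) b)) →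
               F (shift (k * + n) a) (shift (k * + n) b) q ≡ F a b p
    boundary : ∀ a b (p : IsArc n a b) → IsBoundarySeg a b → F a b p ≡ 1ℤ
    ptolemy  : ∀ A B C D → Quad n A B C D →
               (pAB : IsArc n A B) (pBC : IsArc n B C) (pCD : IsArc n C D)
               (pAD : IsArc n A D) (pAC : IsArc n A C) (pBD : IsArc n B D) →
               F A C pAC * F B D pBD ≡ F A B pAB * F C D pCD + F B C pBC * F A D pAD

-- The bridging arc γ_{i,j} is the image of the segment P̂ i Q̂ j.
toBiQF : ∀ {n} → Frieze n → ℤ → ℤ → ℤ
toBiQF Fr i j = Frieze.F Fr (P i) (Q j) _

record IsPosIntPeriodicBiQF (n : ℕ) (u : ℤ → ℤ → ℤ) : Set where
  field
    positive : ∀ i j → 0ℤ < u i j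
    diamond  : ∀ i j →
               u i j * u (i + 1ℤ) (j + 1ℤ) - u i (j + 1ℤ) * u (i + 1ℤ) j ≡ -1ℤ
    periodic : ∀ i j → u (i + + n) (j + + n) ≡ u i j

-- Ptolemy in the quadrilateral P̂ i P̂ (i+1) Q̂ (j+1) Q̂ j, whose two sides on the boundary
-- have value 1, is exactly the quasi-diamond rule; Ptolemy in P̂ i P̂ k Q̂ 1 Q̂ 0 and in
-- P̂ 0 P̂ 1 Q̂ l Q̂ j writes every peripheral value as a 2 × 2 minor of the bridging values, so
-- a frieze is determined by its quasi-frieze.
-- Conversely, realise a positive quasi-frieze as u i j = det (X i) (Y j) with vectors of ℤ²
-- satisfying det (X i) (X (i+1)) = 1 = det (Y (j+1)) (Y j). Such X, Y are found by matching
-- u on row 0 and column 0 only, since the quasi-diamond rule propagates any such agreement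
-- to the whole plane. Then F a b = |det a b| on lifted marked points is the frieze: Ptolemy
-- is the Plücker relation, det is positive on correctly ordered pairs by induction along the
-- chains X and Y, and periodicity of u makes F deck invariant.

module Submission where

open import Defs
open import Data.Nat using (ℕ; _≤_)
open import Data.Integer using (ℤ)
open import Data.Product using (_×_; ∃)
open import Relation.Binary.PropositionalEquality using (_≡_)

open import Data.Bool using (T; _∧_)
open import Data.Bool.Properties using (T-∧)
open import Data.Empty using (⊥-elim)
open import Data.Nat as ℕ using (zero; suc; z≤n; s≤s)
import Data.Nat.Properties as ℕₚ
open import Data.Integer as ℤ
  using (+_; +[1+_]; -[1+_]; _+_; _-_; _*_; -_; ∣_∣; 0ℤ; 1ℤ; -1ℤ; _<_; NonZero; +≤+; +<+; -≤-)
open import Data.Integer.Properties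
open import Data.Integer.Tactic.RingSolver using (solve-∀)
open import Algebra.Properties.AbelianGroup +-0-abelianGroup using (∙-cancelˡ; ∙-cancelʳ)
open import Data.Product using (_,_; proj₁; proj₂; swap)
open import Data.Sum using (_⊎_; inj₁; inj₂)
open import Data.Unit using (tt)
open import Function using (_∘_; Equivalence)
open import Relation.Binary.Definitions using (tri<; tri≈; tri>)
open import Relation.Nullary using (yes; no)
open import Relation.Binary.PropositionalEquality
  using (_≢_; refl; sym; trans; cong; cong₂; subst; module ≡-Reasoning)
open ≡-Reasoning

ℤ-induction : (R : ℤ → Set) → R 0ℤ → (∀ i → R i → R (i + 1ℤ)) → (∀ i → R (i + 1ℤ) → R i) →
              ∀ i → R i
ℤ-induction R base up down (+ zero)     = base
ℤ-induction R base up down (+ suc m)    =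
  subst R (cong +_ (ℕₚ.+-comm m 1)) (up (+ m) (ℤ-induction R base up down (+ m)))
ℤ-induction R base up down -[1+ zero ]  = down -1ℤ base
ℤ-induction R base up down -[1+ suc m ] = down -[1+ suc m ] (ℤ-induction R base up down -[1+ m ])

i<i+1 : ∀ i → i < i + 1ℤ
i<i+1 i = suc[i]≤j⇒i<j (≤-reflexive (+-comm 1ℤ i))

i≤+∣i∣ : ∀ i → i ℤ.≤ + ∣ i ∣
i≤+∣i∣ (+ n)    = ≤-refl
i≤+∣i∣ -[1+ n ] = ℤ.-≤+

<⇒≡+[1+] : ∀ {i k} → i < k → ∃ λ d → i + +[1+ d ] ≡ k
<⇒≡+[1+] {i} {k} i<k = ∣ k - (1ℤ + i) ∣ , (begin
    i + (1ℤ + + ∣ k - (1ℤ + i) ∣)  ≡⟨ cong (λ x → i + (1ℤ + x)) (0≤i⇒+∣i∣≡i 0≤k-1-i) ⟩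
    i + (1ℤ + (k - (1ℤ + i)))      ≡⟨ identity i k ⟩
    k                              ∎)
  where
  0≤k-1-i : 0ℤ ℤ.≤ k - (1ℤ + i)
  0≤k-1-i = i≤j⇒0≤j-i (i<j⇒suc[i]≤j i<k)
  identity : ∀ i k → i + (1ℤ + (k - (1ℤ + i))) ≡ k
  identity = solve-∀

+[1+]-step : ∀ i d → (i + +[1+ d ]) + 1ℤ ≡ i + +[1+ suc d ]
+[1+]-step i d = trans (+-assoc i +[1+ d ] 1ℤ) (cong (λ m → i + + suc m) (ℕₚ.+-comm d 1))

∣∣≡1⇒≡±1 : ∀ x → ∣ x ∣ ≡ 1 → x ≡ 1ℤ ⊎ x ≡ -1ℤ
∣∣≡1⇒≡±1 (+ suc zero)   _ = inj₁ refl
∣∣≡1⇒≡±1 -[1+ zero ]    _ = inj₂ refl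
∣∣≡1⇒≡±1 (+ zero)       ()
∣∣≡1⇒≡±1 (+ suc (suc _)) ()
∣∣≡1⇒≡±1 -[1+ suc _ ]   ()

∣k-i∣≡1⇒adjacent : ∀ i k → ∣ k - i ∣ ≡ 1 → k ≡ i + 1ℤ ⊎ i ≡ k + 1ℤ
∣k-i∣≡1⇒adjacent i k ∣k-i∣≡1 with ∣∣≡1⇒≡±1 (k - i) ∣k-i∣≡1
... | inj₁ k-i≡1  = inj₁ (trans (forward i k) (cong (λ x → i + x) k-i≡1))
  where
  forward : ∀ i k → k ≡ i + (k - i)
  forward = solve-∀
... | inj₂ k-i≡-1 = inj₂ (trans (backward i k) (cong (λ x → k + - x) k-i≡-1))
  where
  backward : ∀ i k → i ≡ k + - (k - i)
  backward = solve-∀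

x≡y+zw⇒y≡x-wz : ∀ {x y} z w → x ≡ y + z * w → y ≡ x - w * z
x≡y+zw⇒y≡x-wz {y = y} z w refl = identity y z w
  where
  identity : ∀ y z w → y ≡ (y + z * w) - w * z
  identity = solve-∀

0<-sum-of-products : ∀ {a b c d} → 0ℤ ℤ.≤ a → 0ℤ < b → 0ℤ < c → 0ℤ < d → 0ℤ < a * b + c * d
0<-sum-of-products {b = b} {d = d} 0≤a 0<b 0<c 0<d =
  +-mono-≤-< (*-monoʳ-≤-nonNeg b {{ℤ.nonNegative (<⇒≤ 0<b)}} 0≤a)
             (*-monoʳ-<-pos d {{ℤ.positive 0<d}} 0<c)

0<x*c⇒0<x : ∀ {x c} → 0ℤ < c → 0ℤ < x * c → 0ℤ < x
0<x*c⇒0<x {c = c} 0<c = *-cancelʳ-<-nonNeg c {{ℤ.nonNegative (<⇒≤ 0<c)}}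

V : Set
V = ℤ × ℤ

det : V → V → ℤ
det (a , b) (c , d) = a * d - b * c

det-cong : ∀ {a b c d a′ b′ c′ d′} → a ≡ a′ → b ≡ b′ → c ≡ c′ → d ≡ d′ →
           det (a , b) (c , d) ≡ det (a′ , b′) (c′ , d′)
det-cong refl refl refl refl = refl

det-antisym : ∀ x y → det y x ≡ - det x y
det-antisym (a , b) (c , d) = identity a b c d
  where
  identity : ∀ a b c d → c * b - d * a ≡ - (a * d - b * c)
  identity = solve-∀

det-swap : ∀ x y → det (swap x) (swap y) ≡ det y x
det-swap (a , b) (c , d) = identity a b c d
  where
  identity : ∀ a b c d → b * c - a * d ≡ c * b - d * a
  identity = solve-∀

det-neg-transpose : ∀ a b c d → det (- a , - c) (- b , - d) ≡ det (a , b) (c , d)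
det-neg-transpose = identity
  where
  identity : ∀ a b c d → (- a) * (- d) - (- c) * (- b) ≡ a * d - b * c
  identity = solve-∀

plücker : ∀ a b c d → det a c * det b d ≡ det a b * det c d + det b c * det a d
plücker (a₁ , a₂) (b₁ , b₂) (c₁ , c₂) (d₁ , d₂) = identity a₁ a₂ b₁ b₂ c₁ c₂ d₁ d₂
  where
  identity : ∀ a₁ a₂ b₁ b₂ c₁ c₂ d₁ d₂ →
    (a₁ * c₂ - a₂ * c₁) * (b₁ * d₂ - b₂ * d₁) ≡
    (a₁ * b₂ - a₂ * b₁) * (c₁ * d₂ - c₂ * d₁) + (b₁ * c₂ - b₂ * c₁) * (a₁ * d₂ - a₂ * d₁)
  identity = solve-∀

det-cauchy-binet : ∀ a b c d → det a b * det c d ≡ det (det a c , det a d) (det b c , det b d)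
det-cauchy-binet (a₁ , a₂) (b₁ , b₂) (c₁ , c₂) (d₁ , d₂) = identity a₁ a₂ b₁ b₂ c₁ c₂ d₁ d₂
  where
  identity : ∀ a₁ a₂ b₁ b₂ c₁ c₂ d₁ d₂ →
    (a₁ * b₂ - a₂ * b₁) * (c₁ * d₂ - c₂ * d₁) ≡
    (a₁ * c₂ - a₂ * c₁) * (b₁ * d₂ - b₂ * d₁) - (a₁ * d₂ - a₂ * d₁) * (b₁ * c₂ - b₂ * c₁)
  identity = solve-∀

det-frame : ∀ a b c d → det a b ≡ 1ℤ → det c d ≡ det (det a c , det a d) (det b c , det b d)
det-frame a b c d ab≡1 = begin
  det c d                                         ≡⟨ sym (*-identityˡ (det c d)) ⟩
  1ℤ * det c d                                    ≡⟨ cong (_* det c d) (sym ab≡1) ⟩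
  det a b * det c d                               ≡⟨ det-cauchy-binet a b c d ⟩
  det (det a c , det a d) (det b c , det b d)     ∎

det-cancel₁₁ : ∀ {a b c d a′ b′ c′ d′} .{{_ : NonZero d′}} →
  det (a , b) (c , d) ≡ det (a′ , b′) (c′ , d′) → b ≡ b′ → c ≡ c′ → d ≡ d′ → a ≡ a′
det-cancel₁₁ {a} {b} {c} {d} {a′} eq refl refl refl =
  *-cancelʳ-≡ a a′ d (∙-cancelʳ (- (b * c)) _ _ eq)

det-cancel₁₂ : ∀ {a b c d a′ b′ c′ d′} .{{_ : NonZero c′}} →
  det (a , b) (c , d) ≡ det (a′ , b′) (c′ , d′) → a ≡ a′ → c ≡ c′ → d ≡ d′ → b ≡ b′
det-cancel₁₂ {a} {b} {c} {d} {b′ = b′} eq refl refl refl =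
  *-cancelʳ-≡ b b′ c (neg-injective (∙-cancelˡ (a * d) _ _ eq))

det-cancel₂₁ : ∀ {a b c d a′ b′ c′ d′} .{{_ : NonZero b′}} →
  det (a , b) (c , d) ≡ det (a′ , b′) (c′ , d′) → a ≡ a′ → b ≡ b′ → d ≡ d′ → c ≡ c′
det-cancel₂₁ {a} {b} {c} {d} {c′ = c′} eq refl refl refl =
  *-cancelˡ-≡ b c c′ (neg-injective (∙-cancelˡ (a * d) _ _ eq))

det-cancel₂₂ : ∀ {a b c d a′ b′ c′ d′} .{{_ : NonZero a′}} →
  det (a , b) (c , d) ≡ det (a′ , b′) (c′ , d′) → a ≡ a′ → b ≡ b′ → c ≡ c′ → d ≡ d′
det-cancel₂₂ {a} {b} {c} {d} {d′ = d′} eq refl refl refl =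
  *-cancelˡ-≡ a d d′ (∙-cancelʳ (- (b * c)) _ _ eq)

-- The Plücker relation for v i, v k, v (k+1), y writes det (v i) (v (k+1)) · det (v k) y
-- as a sum of a nonnegative and a positive term, once det (v i) (v k) ≥ 0.
det-chain-positive : (v : ℤ → V) (y : V) →
  (∀ k → 0ℤ < det (v k) (v (k + 1ℤ))) → (∀ k → 0ℤ < det (v k) y) →
  ∀ {i k} → i < k → 0ℤ < det (v i) (v k)
det-chain-positive v y consecutive left {i} i<k with <⇒≡+[1+] i<k
... | d , refl = reach d
  where
  extend : ∀ k → 0ℤ < det (v i) (v k) → 0ℤ < det (v i) (v (k + 1ℤ))
  extend k 0<ik = 0<x*c⇒0<x (left k)
    (subst (0ℤ <_) (sym (plücker (v i) (v k) (v (k + 1ℤ)) y))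
      (0<-sum-of-products (<⇒≤ 0<ik) (left (k + 1ℤ)) (consecutive k) (left i)))
  reach : ∀ d → 0ℤ < det (v i) (v (i + +[1+ d ]))
  reach zero    = consecutive i
  reach (suc d) = subst (λ k → 0ℤ < det (v i) (v k)) (+[1+]-step i d) (extend _ (reach d))

minor : {A B : Set} → (A → B → ℤ) → A → A → B → B → ℤ
minor g a b c d = det (g a c , g a d) (g b c , g b d)

minor-cong : ∀ {A B : Set} {g h : A → B → ℤ} → (∀ x y → g x y ≡ h x y) →
             ∀ a b c d → minor g a b c d ≡ minor h a b c d
minor-cong g≗h a b c d = det-cong (g≗h a c) (g≗h a d) (g≗h b c) (g≗h b d)

minor-swap-columns : ∀ {A B : Set} (g : A → B → ℤ) a b c d → minor g a b c d ≡ - minor g a b d c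
minor-swap-columns g a b c d = trans (det-swap x y) (det-antisym x y)
  where
  x y : V
  x = (g a d , g a c)
  y = (g b d , g b c)

QuasiDiamond : (ℤ → ℤ → ℤ) → Set
QuasiDiamond u = ∀ i j → minor u i (i + 1ℤ) j (j + 1ℤ) ≡ -1ℤ

-- Each entry of a window is determined by the other three once its opposite entry is
-- nonzero, so agreement spreads from row 0 and column 0, one row at a time.
quasiDiamond-unique : ∀ {u w} → (∀ i j → NonZero (u i j)) → QuasiDiamond u → QuasiDiamond w →
  (∀ j → w 0ℤ j ≡ u 0ℤ j) → (∀ i → w i 0ℤ ≡ u i 0ℤ) → ∀ i j → w i j ≡ u i j
quasiDiamond-unique {u} {w} nz du dw row col =
  ℤ-induction (λ i → ∀ j → w i j ≡ u i j) row next previous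
  where
  window : ∀ i j → minor w i (i + 1ℤ) j (j + 1ℤ) ≡ minor u i (i + 1ℤ) j (j + 1ℤ)
  window i j = trans (dw i j) (sym (du i j))

  next : ∀ i → (∀ j → w i j ≡ u i j) → ∀ j → w (i + 1ℤ) j ≡ u (i + 1ℤ) j
  next i eq = ℤ-induction (λ j → w (i + 1ℤ) j ≡ u (i + 1ℤ) j) (col (i + 1ℤ))
    (λ j eqⱼ → det-cancel₂₂ {{nz i j}} (window i j) (eq j) (eq (j + 1ℤ)) eqⱼ)
    (λ j eqⱼ₊₁ → det-cancel₂₁ {{nz i (j + 1ℤ)}} (window i j) (eq j) (eq (j + 1ℤ)) eqⱼ₊₁)

  previous : ∀ i → (∀ j → w (i + 1ℤ) j ≡ u (i + 1ℤ) j) → ∀ j → w i j ≡ u i j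
  previous i eq = ℤ-induction (λ j → w i j ≡ u i j) (col i)
    (λ j eqⱼ → det-cancel₁₂ {{nz (i + 1ℤ) j}} (window i j) eqⱼ (eq j) (eq (j + 1ℤ)))
    (λ j eqⱼ₊₁ → det-cancel₁₁ {{nz (i + 1ℤ) (j + 1ℤ)}} (window i j) eqⱼ₊₁ (eq j) (eq (j + 1ℤ)))

periodic-multiple : ∀ {A : Set} {u : ℤ → ℤ → A} m → (∀ i j → u (i + m) (j + m) ≡ u i j) →
                    ∀ K i j → u (i + K * m) (j + K * m) ≡ u i j
periodic-multiple {u = u} m per = ℤ-induction (λ K → ∀ i j → u (i + K * m) (j + K * m) ≡ u i j)
    (λ i j → cong₂ u (+-identityʳ i) (+-identityʳ j))
    (λ K ih i j → trans (shifted i j K) (trans (per _ _) (ih i j)))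
    (λ K ih i j → trans (sym (per _ _)) (trans (sym (shifted i j K)) (ih i j)))
  where
  step : ∀ i K m → i + (K + 1ℤ) * m ≡ (i + K * m) + m
  step = solve-∀
  shifted : ∀ i j K →
    u (i + (K + 1ℤ) * m) (j + (K + 1ℤ) * m) ≡ u ((i + K * m) + m) ((j + K * m) + m)
  shifted i j K = cong₂ u (step i K m) (step j K m)

<ᵖ-trans : ∀ {a b c} → a <ᵖ b → b <ᵖ c → a <ᵖ c
<ᵖ-trans (PP i<j) (PP j<k) = PP (<-trans i<j j<k)
<ᵖ-trans (PP _)   PQ       = PQ
<ᵖ-trans PQ       (QQ _)   = PQ
<ᵖ-trans (QQ k<j) (QQ l<k) = QQ (<-trans l<k k<j)

P-mono : ∀ {i k} → i ℤ.≤ k → P i ≤ᵖ P k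
P-mono {i} {k} i≤k with i ℤ.≟ k
... | yes refl = inj₂ refl
... | no i≢k   = inj₁ (PP (≤∧≢⇒< i≤k i≢k))

Q-antitone : ∀ {j l} → l ℤ.≤ j → Q j ≤ᵖ Q l
Q-antitone {j} {l} l≤j with l ℤ.≟ j
... | yes refl = inj₂ refl
... | no l≢j   = inj₁ (QQ (≤∧≢⇒< l≤j l≢j))

Peripheral : ℕ → ℤ → ℤ → Set
Peripheral n i k = T ((1 ℕ.≤ᵇ ∣ k - i ∣) ∧ (∣ k - i ∣ ℕ.≤ᵇ n))

peripheral⇒1≤ : ∀ {n} i k → Peripheral n i k → 1 ℕ.≤ ∣ k - i ∣
peripheral⇒1≤ i k p = ℕₚ.≤ᵇ⇒≤ 1 _ (proj₁ (Equivalence.to T-∧ p))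

peripheral⇒≤n : ∀ {n} i k → Peripheral n i k → ∣ k - i ∣ ℕ.≤ n
peripheral⇒≤n i k p = ℕₚ.≤ᵇ⇒≤ _ _ (proj₂ (Equivalence.to T-∧ p))

peripheral⇒≢ : ∀ {n} i k → Peripheral n i k → i ≢ k
peripheral⇒≢ {n} i .i p refl with subst (λ x → 1 ℕ.≤ ∣ x ∣) (+-inverseʳ i) (peripheral⇒1≤ {n} i i p)
... | ()

peripheral⇒≤ : ∀ {n} i k → Peripheral n i k → k ℤ.≤ i + + n
peripheral⇒≤ {n} i k p =
  ≤-trans (≤-reflexive (identity i k)) (+-monoʳ-≤ i k-i≤n)
  where
  k-i≤n : k - i ℤ.≤ + n
  k-i≤n = ≤-trans (i≤+∣i∣ (k - i)) (+≤+ (peripheral⇒≤n {n} i k p))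
  identity : ∀ i k → k ≡ i + (k - i)
  identity = solve-∀

peripheral-sym : ∀ {n} i k → Peripheral n i k → Peripheral n k i
peripheral-sym {n} i k = subst (λ x → T ((1 ℕ.≤ᵇ x) ∧ (x ℕ.≤ᵇ n))) (∣i-j∣≡∣j-i∣ k i)

distance-1⇒peripheral : ∀ {n} → 1 ≤ n → ∀ i k → ∣ k - i ∣ ≡ 1 → Peripheral n i k
distance-1⇒peripheral {n} 1≤n i k ∣k-i∣≡1 =
  subst (λ x → T ((1 ℕ.≤ᵇ x) ∧ (x ℕ.≤ᵇ n))) (sym ∣k-i∣≡1)
        (Equivalence.from T-∧ (ℕₚ.≤⇒≤ᵇ (ℕₚ.≤-refl {1}) , ℕₚ.≤⇒≤ᵇ 1≤n))

isArc-sym : ∀ {n} a b → IsArc n a b → IsArc n b a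
isArc-sym {n} (P i) (P k) = peripheral-sym {n} i k
isArc-sym (P i) (Q j) _ = tt
isArc-sym (Q j) (P i) _ = tt
isArc-sym {n} (Q j) (Q l) = peripheral-sym {n} j l

arc-ordered : ∀ {n} a b → IsArc n a b → a <ᵖ b ⊎ b <ᵖ a
arc-ordered (P i) (Q j) _ = inj₁ PQ
arc-ordered (Q j) (P i) _ = inj₂ PQ
arc-ordered {n} (P i) (P k) p with <-cmp i k
... | tri< i<k _ _ = inj₁ (PP i<k)
... | tri≈ _ i≡k _ = ⊥-elim (peripheral⇒≢ {n} i k p i≡k)
... | tri> _ _ k<i = inj₂ (PP k<i)
arc-ordered {n} (Q j) (Q l) p with <-cmp j l
... | tri< j<l _ _ = inj₂ (QQ j<l)
... | tri≈ _ j≡l _ = ⊥-elim (peripheral⇒≢ {n} j l p j≡l)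
... | tri> _ _ l<j = inj₁ (QQ l<j)

boundary⇒arc : ∀ {n} → 1 ≤ n → ∀ a b → IsBoundarySeg a b → IsArc n a b
boundary⇒arc 1≤n (P i) (P k) = distance-1⇒peripheral 1≤n i k
boundary⇒arc 1≤n (Q j) (Q l) = distance-1⇒peripheral 1≤n j l

boundary-P : ∀ i → IsBoundarySeg (P i) (P (i + 1ℤ))
boundary-P i = cong ∣_∣ (identity i)
  where
  identity : ∀ i → (i + 1ℤ) - i ≡ 1ℤ
  identity = solve-∀

boundary-Q : ∀ j → IsBoundarySeg (Q (j + 1ℤ)) (Q j)
boundary-Q j = cong ∣_∣ (identity j)
  where
  identity : ∀ j → j - (j + 1ℤ) ≡ -1ℤ
  identity = solve-∀

nonzero-multiple-cases : ∀ n K → K ≢ 0ℤ → + n ℤ.≤ K * + n ⊎ K * + n ℤ.≤ - + n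
nonzero-multiple-cases n (+ zero)   K≢0 = ⊥-elim (K≢0 refl)
nonzero-multiple-cases n +[1+ k ]   _   =
  inj₁ (subst (ℤ._≤ +[1+ k ] * + n) (*-identityˡ (+ n))
              (*-monoʳ-≤-nonNeg (+ n) {1ℤ} {+[1+ k ]} (+≤+ (s≤s z≤n))))
nonzero-multiple-cases n -[1+ k ]   _   =
  inj₂ (subst (-[1+ k ] * + n ℤ.≤_) (-1*i≡-i (+ n))
              (*-monoʳ-≤-nonNeg (+ n) { -[1+ k ]} { -1ℤ} (-≤- z≤n)))

≤-translate-up : ∀ i N {k M} → k ℤ.≤ i + N → N ℤ.≤ M → k ℤ.≤ i + M
≤-translate-up i N k≤i+N N≤M = ≤-trans k≤i+N (+-monoʳ-≤ i N≤M)

≤-translate-down : ∀ i N {k M} → k ℤ.≤ i + N → M ℤ.≤ - N → k + M ℤ.≤ i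
≤-translate-down i N k≤i+N M≤-N =
  ≤-trans (+-mono-≤ k≤i+N M≤-N) (≤-reflexive (identity i N))
  where
  identity : ∀ i x → (i + x) + - x ≡ i
  identity = solve-∀

i+j≤i : ∀ i {j} → j ℤ.≤ 0ℤ → i + j ℤ.≤ i
i+j≤i i j≤0 = ≤-trans (+-monoʳ-≤ i j≤0) (≤-reflexive (+-identityʳ i))

-- A translate by M ≥ n lies in the boundary arc from P̂ k to Q̂ l, one by M ≤ -n in the
-- arc from Q̂ j round to P̂ i.
emb-PPQQ : ∀ {n i k j l} → k ℤ.≤ i + + n → l ℤ.≤ j + + n → Emb n (P i) (P k) (Q l) (Q j)
emb-PPQQ {n} {i} {k} {j} {l} k≤i+n l≤j+n K K≢0 with nonzero-multiple-cases n K K≢0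
... | inj₁ n≤M = inj₂ (inj₁
        ( inj₁ (P-mono (≤-translate-up i (+ n) k≤i+n n≤M) , inj₁ PQ)
        , inj₁ (P-mono (i≤i+j k (K * + n) {{ℤ.nonNegative 0≤M}}) , inj₁ PQ)
        , inj₁ (inj₁ PQ , Q-antitone (i≤i+j l (K * + n) {{ℤ.nonNegative 0≤M}}))
        , inj₁ (inj₁ PQ , Q-antitone (≤-translate-up j (+ n) l≤j+n n≤M))))
  where
  0≤M : 0ℤ ℤ.≤ K * + n
  0≤M = ≤-trans (+≤+ z≤n) n≤M
... | inj₂ M≤-n = inj₂ (inj₂ (inj₂
        ( inj₂ (PQ , inj₂ (P-mono (i+j≤i i M≤0)))
        , inj₂ (PQ , inj₂ (P-mono (≤-translate-down i (+ n) k≤i+n M≤-n)))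
        , inj₂ (PQ , inj₁ (Q-antitone (≤-translate-down j (+ n) l≤j+n M≤-n)))
        , inj₂ (PQ , inj₁ (Q-antitone (i+j≤i j M≤0))))))
  where
  M≤0 : K * + n ℤ.≤ 0ℤ
  M≤0 = ≤-trans M≤-n neg-≤-pos

quad-PPQQ : ∀ {n i k j l} → i < k → k ℤ.≤ i + + n → j < l → l ℤ.≤ j + + n →
            Quad n (P i) (P k) (Q l) (Q j)
quad-PPQQ i<k k≤i+n j<l l≤j+n = inj₁ (inj₁ (PP i<k , PQ , QQ j<l) , emb-PPQQ k≤i+n l≤j+n)

module _ (f : Pt → Pt → ℤ) (f-sym : ∀ a b → f a b ≡ f b a) where

  PtolemyAt : Pt → Pt → Pt → Pt → Set
  PtolemyAt a b c d = f a c * f b d ≡ f a b * f c d + f b c * f a d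

  ptolemy-rotate : ∀ {a b c d} → PtolemyAt a b c d → PtolemyAt b c d a
  ptolemy-rotate {a} {b} {c} {d} rel = begin
    f b d * f c a                  ≡⟨ cong (f b d *_) (f-sym c a) ⟩
    f b d * f a c                  ≡⟨ *-comm (f b d) (f a c) ⟩
    f a c * f b d                  ≡⟨ rel ⟩
    f a b * f c d + f b c * f a d  ≡⟨ +-comm (f a b * f c d) (f b c * f a d) ⟩
    f b c * f a d + f a b * f c d  ≡⟨ cong₂ _+_ (cong (f b c *_) (f-sym a d))
                                                (trans (*-comm (f a b) (f c d))
                                                       (cong (f c d *_) (f-sym a b))) ⟩
    f b c * f d a + f c d * f b a  ∎

  ptolemy-reverse : ∀ {a b c d} → PtolemyAt a b c d → PtolemyAt d c b a
  ptolemy-reverse {a} {b} {c} {d} rel = begin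
    f d b * f c a                  ≡⟨ cong₂ _*_ (f-sym d b) (f-sym c a) ⟩
    f b d * f a c                  ≡⟨ *-comm (f b d) (f a c) ⟩
    f a c * f b d                  ≡⟨ rel ⟩
    f a b * f c d + f b c * f a d  ≡⟨ cong₂ _+_ (trans (*-comm (f a b) (f c d))
                                                       (cong₂ _*_ (f-sym c d) (f-sym a b)))
                                                (cong₂ _*_ (f-sym b c) (f-sym a d)) ⟩
    f d c * f b a + f c b * f d a  ∎

  module _ (sorted : ∀ {a b c d} → a <ᵖ b → b <ᵖ c → c <ᵖ d → PtolemyAt a b c d) where

    ptolemy-cyclic : ∀ {a b c d} → Cyc a b c d → PtolemyAt a b c d
    ptolemy-cyclic (inj₁ (ab , bc , cd))               = sorted ab bc cd
    ptolemy-cyclic (inj₂ (inj₁ (bc , cd , da)))        =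
      ptolemy-rotate (ptolemy-rotate (ptolemy-rotate (sorted bc cd da)))
    ptolemy-cyclic (inj₂ (inj₂ (inj₁ (cd , da , ab)))) =
      ptolemy-rotate (ptolemy-rotate (sorted cd da ab))
    ptolemy-cyclic (inj₂ (inj₂ (inj₂ (da , ab , bc)))) = ptolemy-rotate (sorted da ab bc)

    ptolemy-quad : ∀ {n a b c d} → Quad n a b c d → PtolemyAt a b c d
    ptolemy-quad (inj₁ (cyc , _)) = ptolemy-cyclic cyc
    ptolemy-quad (inj₂ (cyc , _)) = ptolemy-reverse (ptolemy-cyclic cyc)

module _ {n : ℕ} (Fr : Frieze n) where
  open Frieze Fr

  ptolemy-PPQQ : ∀ {i k j l} (p : IsArc n (P i) (P k)) (q : IsArc n (Q l) (Q j)) → i < k → j < l →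
                 F (P i) (P k) p * F (Q l) (Q j) q ≡ minor (toBiQF Fr) i k l j
  ptolemy-PPQQ {i} {k} {j} {l} p q i<k j<l =
    x≡y+zw⇒y≡x-wz (toBiQF Fr k l) (toBiQF Fr i j)
                  (ptolemy (P i) (P k) (Q l) (Q j) quad p tt q tt tt tt)
    where
    quad : Quad n (P i) (P k) (Q l) (Q j)
    quad = quad-PPQQ i<k (peripheral⇒≤ {n} i k p) j<l
                         (peripheral⇒≤ {n} j l (peripheral-sym {n} l j q))

  toBiQF-quasiDiamond : 1 ≤ n → QuasiDiamond (toBiQF Fr)
  toBiQF-quasiDiamond 1≤n i j = begin
    minor (toBiQF Fr) i (i + 1ℤ) j (j + 1ℤ)
      ≡⟨ minor-swap-columns (toBiQF Fr) i (i + 1ℤ) j (j + 1ℤ) ⟩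
    - minor (toBiQF Fr) i (i + 1ℤ) (j + 1ℤ) j
      ≡⟨ cong -_ (sym (ptolemy-PPQQ p q (i<i+1 i) (i<i+1 j))) ⟩
    - (F (P i) (P (i + 1ℤ)) p * F (Q (j + 1ℤ)) (Q j) q)
      ≡⟨ cong -_ (cong₂ _*_ (boundary (P i) (P (i + 1ℤ)) p (boundary-P i))
                            (boundary (Q (j + 1ℤ)) (Q j) q (boundary-Q j))) ⟩
    -1ℤ
      ∎
    where
    p : IsArc n (P i) (P (i + 1ℤ))
    p = boundary⇒arc 1≤n (P i) (P (i + 1ℤ)) (boundary-P i)
    q : IsArc n (Q (j + 1ℤ)) (Q j)
    q = boundary⇒arc 1≤n (Q (j + 1ℤ)) (Q j) (boundary-Q j)

  toBiQF-periodic : ∀ i j → toBiQF Fr (i + + n) (j + + n) ≡ toBiQF Fr i j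
  toBiQF-periodic i j = begin
    toBiQF Fr (i + + n) (j + + n)
      ≡⟨ cong (λ m → toBiQF Fr (i + m) (j + m)) (sym (*-identityˡ (+ n))) ⟩
    toBiQF Fr (i + 1ℤ * + n) (j + 1ℤ * + n)
      ≡⟨ deck 1ℤ (P i) (Q j) tt tt ⟩
    toBiQF Fr i j
      ∎

  toBiQF-isPosIntPeriodicBiQF : 1 ≤ n → IsPosIntPeriodicBiQF n (toBiQF Fr)
  toBiQF-isPosIntPeriodicBiQF 1≤n = record
    { positive = λ i j → positive (P i) (Q j) tt
    ; diamond  = toBiQF-quasiDiamond 1≤n
    ; periodic = toBiQF-periodic
    }

  peripheral-P-value : 1 ≤ n → ∀ {i k} (p : IsArc n (P i) (P k)) → i < k →
                       F (P i) (P k) p ≡ minor (toBiQF Fr) i k 1ℤ 0ℤ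
  peripheral-P-value 1≤n {i} {k} p i<k = begin
    F (P i) (P k) p                      ≡⟨ sym (*-identityʳ _) ⟩
    F (P i) (P k) p * 1ℤ                 ≡⟨ cong (F (P i) (P k) p *_) (sym (boundary (Q 1ℤ) (Q 0ℤ) q refl)) ⟩
    F (P i) (P k) p * F (Q 1ℤ) (Q 0ℤ) q  ≡⟨ ptolemy-PPQQ p q i<k (i<i+1 0ℤ) ⟩
    minor (toBiQF Fr) i k 1ℤ 0ℤ          ∎
    where
    q : IsArc n (Q 1ℤ) (Q 0ℤ)
    q = boundary⇒arc 1≤n (Q 1ℤ) (Q 0ℤ) refl

  peripheral-Q-value : 1 ≤ n → ∀ {j l} (q : IsArc n (Q l) (Q j)) → j < l →
                       F (Q l) (Q j) q ≡ minor (toBiQF Fr) 0ℤ 1ℤ l j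
  peripheral-Q-value 1≤n {j} {l} q j<l = begin
    F (Q l) (Q j) q                      ≡⟨ sym (*-identityˡ _) ⟩
    1ℤ * F (Q l) (Q j) q                 ≡⟨ cong (_* F (Q l) (Q j) q) (sym (boundary (P 0ℤ) (P 1ℤ) p refl)) ⟩
    F (P 0ℤ) (P 1ℤ) p * F (Q l) (Q j) q  ≡⟨ ptolemy-PPQQ p q (i<i+1 0ℤ) j<l ⟩
    minor (toBiQF Fr) 0ℤ 1ℤ l j          ∎
    where
    p : IsArc n (P 0ℤ) (P 1ℤ)
    p = boundary⇒arc 1≤n (P 0ℤ) (P 1ℤ) refl

module _ {n : ℕ} (1≤n : 1 ≤ n) (Fr Gr : Frieze n)
         (same : ∀ i j → toBiQF Fr i j ≡ toBiQF Gr i j) where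
  open Frieze

  frieze-determined-ordered : ∀ {a b} → a <ᵖ b → (p : IsArc n a b) → F Fr a b p ≡ F Gr a b p
  frieze-determined-ordered (PP {i} {k} i<k) p = begin
    F Fr (P i) (P k) p             ≡⟨ peripheral-P-value Fr 1≤n p i<k ⟩
    minor (toBiQF Fr) i k 1ℤ 0ℤ    ≡⟨ minor-cong same i k 1ℤ 0ℤ ⟩
    minor (toBiQF Gr) i k 1ℤ 0ℤ    ≡⟨ sym (peripheral-P-value Gr 1≤n p i<k) ⟩
    F Gr (P i) (P k) p             ∎
  frieze-determined-ordered (PQ {i} {j}) _ = same i j
  frieze-determined-ordered (QQ {j} {l} l<j) q = begin
    F Fr (Q j) (Q l) q             ≡⟨ peripheral-Q-value Fr 1≤n q l<j ⟩
    minor (toBiQF Fr) 0ℤ 1ℤ j l    ≡⟨ minor-cong same 0ℤ 1ℤ j l ⟩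
    minor (toBiQF Gr) 0ℤ 1ℤ j l    ≡⟨ sym (peripheral-Q-value Gr 1≤n q l<j) ⟩
    F Gr (Q j) (Q l) q             ∎

  frieze-determined : ∀ a b (p : IsArc n a b) → F Fr a b p ≡ F Gr a b p
  frieze-determined a b p with arc-ordered a b p
  ... | inj₁ a<b = frieze-determined-ordered a<b p
  ... | inj₂ b<a = begin
    F Fr a b p   ≡⟨ symm Fr a b p p′ ⟩
    F Fr b a p′  ≡⟨ frieze-determined-ordered b<a p′ ⟩
    F Gr b a p′  ≡⟨ symm Gr b a p′ p ⟩
    F Gr a b p   ∎
    where
    p′ : IsArc n b a
    p′ = isArc-sym a b p

module _ {n : ℕ} {u : ℤ → ℤ → ℤ} (H : IsPosIntPeriodicBiQF n u) where
  open IsPosIntPeriodicBiQF H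

  X : ℤ → V
  X i = (u i 0ℤ , - u i 1ℤ)

  -- Y j = u 0 j · X 1 − u 1 j · X 0, so that det (X 0) (Y j) = u 0 j and det (X 1) (Y j) = u 1 j.
  Y : ℤ → V
  Y j = (u 0ℤ j * u 1ℤ 0ℤ - u 1ℤ j * u 0ℤ 0ℤ , u 0ℤ j * (- u 1ℤ 1ℤ) - u 1ℤ j * (- u 0ℤ 1ℤ))

  det-X-X+1 : ∀ i → det (X i) (X (i + 1ℤ)) ≡ 1ℤ
  det-X-X+1 i =
    trans (identity (u i 0ℤ) (u i 1ℤ) (u (i + 1ℤ) 0ℤ) (u (i + 1ℤ) 1ℤ)) (cong -_ (diamond i 0ℤ))
    where
    identity : ∀ a b c d → a * (- d) - (- b) * c ≡ - (a * d - b * c)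
    identity = solve-∀

  det-X₀-X₁*t≡t : ∀ t → det (X 0ℤ) (X 1ℤ) * t ≡ t
  det-X₀-X₁*t≡t t = trans (cong (_* t) (det-X-X+1 0ℤ)) (*-identityˡ t)

  det-X₀-Y : ∀ j → det (X 0ℤ) (Y j) ≡ u 0ℤ j
  det-X₀-Y j = trans (identity (u 0ℤ 0ℤ) (u 0ℤ 1ℤ) (u 1ℤ 0ℤ) (u 1ℤ 1ℤ) (u 0ℤ j) (u 1ℤ j))
                     (det-X₀-X₁*t≡t (u 0ℤ j))
    where
    identity : ∀ a b c d s t →
      a * (s * (- d) - t * (- b)) - (- b) * (s * c - t * a) ≡ (a * (- d) - (- b) * c) * s
    identity = solve-∀

  det-X₁-Y : ∀ j → det (X 1ℤ) (Y j) ≡ u 1ℤ j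
  det-X₁-Y j = trans (identity (u 0ℤ 0ℤ) (u 0ℤ 1ℤ) (u 1ℤ 0ℤ) (u 1ℤ 1ℤ) (u 0ℤ j) (u 1ℤ j))
                     (det-X₀-X₁*t≡t (u 1ℤ j))
    where
    identity : ∀ a b c d s t →
      c * (s * (- d) - t * (- b)) - (- d) * (s * c - t * a) ≡ (a * (- d) - (- b) * c) * t
    identity = solve-∀

  det-X-Y₀ : ∀ i → det (X i) (Y 0ℤ) ≡ u i 0ℤ
  det-X-Y₀ i = trans (identity (u 0ℤ 0ℤ) (u 0ℤ 1ℤ) (u 1ℤ 0ℤ) (u 1ℤ 1ℤ) (u i 0ℤ) (u i 1ℤ))
                     (det-X₀-X₁*t≡t (u i 0ℤ))
    where
    identity : ∀ a b c d p q →
      p * (a * (- d) - c * (- b)) - (- q) * (a * c - c * a) ≡ (a * (- d) - (- b) * c) * p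
    identity = solve-∀

  det-Y-Y+1 : ∀ j → det (Y j) (Y (j + 1ℤ)) ≡ -1ℤ
  det-Y-Y+1 j = begin
    det (Y j) (Y (j + 1ℤ))
      ≡⟨ det-frame (X 0ℤ) (X 1ℤ) (Y j) (Y (j + 1ℤ)) (det-X-X+1 0ℤ) ⟩
    det (det (X 0ℤ) (Y j) , det (X 0ℤ) (Y (j + 1ℤ))) (det (X 1ℤ) (Y j) , det (X 1ℤ) (Y (j + 1ℤ)))
      ≡⟨ det-cong (det-X₀-Y j) (det-X₀-Y (j + 1ℤ)) (det-X₁-Y j) (det-X₁-Y (j + 1ℤ)) ⟩
    minor u 0ℤ 1ℤ j (j + 1ℤ)
      ≡⟨ diamond 0ℤ j ⟩
    -1ℤ
      ∎

  det-X-Y : ∀ i j → det (X i) (Y j) ≡ u i j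
  det-X-Y = quasiDiamond-unique (λ i j → ℤ.>-nonZero (positive i j)) diamond quasiDiamond-XY
                                det-X₀-Y det-X-Y₀
    where
    quasiDiamond-XY : QuasiDiamond (λ i j → det (X i) (Y j))
    quasiDiamond-XY i j =
      trans (sym (det-frame (X i) (X (i + 1ℤ)) (Y j) (Y (j + 1ℤ)) (det-X-X+1 i))) (det-Y-Y+1 j)

  det-Y+1-Y : ∀ j → det (Y (j + 1ℤ)) (Y j) ≡ 1ℤ
  det-Y+1-Y j = trans (det-antisym (Y j) (Y (j + 1ℤ))) (cong -_ (det-Y-Y+1 j))

  det-Y-X : ∀ i j → det (Y j) (X i) ≡ - u i j
  det-Y-X i j = trans (det-antisym (X i) (Y j)) (cong -_ (det-X-Y i j))

  det-X-X : ∀ i k j → det (X i) (X k) ≡ minor u i k (j + 1ℤ) j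
  det-X-X i k j = begin
    det (X i) (X k)
      ≡⟨ det-frame (Y (j + 1ℤ)) (Y j) (X i) (X k) (det-Y+1-Y j) ⟩
    det (det (Y (j + 1ℤ)) (X i) , det (Y (j + 1ℤ)) (X k)) (det (Y j) (X i) , det (Y j) (X k))
      ≡⟨ det-cong (det-Y-X i (j + 1ℤ)) (det-Y-X k (j + 1ℤ)) (det-Y-X i j) (det-Y-X k j) ⟩
    det (- u i (j + 1ℤ) , - u k (j + 1ℤ)) (- u i j , - u k j)
      ≡⟨ det-neg-transpose (u i (j + 1ℤ)) (u i j) (u k (j + 1ℤ)) (u k j) ⟩
    minor u i k (j + 1ℤ) j
      ∎

  det-Y-Y : ∀ j l i → det (Y j) (Y l) ≡ minor u i (i + 1ℤ) j l
  det-Y-Y j l i = trans (det-frame (X i) (X (i + 1ℤ)) (Y j) (Y l) (det-X-X+1 i))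
                        (minor-cong det-X-Y i (i + 1ℤ) j l)

  vec : Pt → V
  vec (P i) = X i
  vec (Q j) = Y j

  module _ (M : ℤ) (per : ∀ i j → u (i + M) (j + M) ≡ u i j) where

    det-vec-shift : ∀ a b → det (vec (shift M a)) (vec (shift M b)) ≡ det (vec a) (vec b)
    det-vec-shift (P i) (Q j) =
      trans (det-X-Y (i + M) (j + M)) (trans (per i j) (sym (det-X-Y i j)))
    det-vec-shift (Q j) (P i) = begin
      det (Y (j + M)) (X (i + M))    ≡⟨ det-antisym (X (i + M)) (Y (j + M)) ⟩
      - det (X (i + M)) (Y (j + M))  ≡⟨ cong -_ (det-vec-shift (P i) (Q j)) ⟩
      - det (X i) (Y j)              ≡⟨ sym (det-antisym (X i) (Y j)) ⟩
      det (Y j) (X i)                ∎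
    det-vec-shift (P i) (P k) = begin
      det (X (i + M)) (X (k + M))
        ≡⟨ det-X-X (i + M) (k + M) M ⟩
      minor u (i + M) (k + M) (M + 1ℤ) M
        ≡⟨ cong₂ (minor u (i + M) (k + M)) (+-comm M 1ℤ) (sym (+-identityˡ M)) ⟩
      minor u (i + M) (k + M) (1ℤ + M) (0ℤ + M)
        ≡⟨ minor-cong per i k 1ℤ 0ℤ ⟩
      minor u i k 1ℤ 0ℤ
        ≡⟨ sym (det-X-X i k 0ℤ) ⟩
      det (X i) (X k)
        ∎
    det-vec-shift (Q j) (Q l) = begin
      det (Y (j + M)) (Y (l + M))
        ≡⟨ det-Y-Y (j + M) (l + M) M ⟩
      minor u M (M + 1ℤ) (j + M) (l + M)
        ≡⟨ cong₂ (λ x y → minor u x y (j + M) (l + M)) (sym (+-identityˡ M)) (+-comm M 1ℤ) ⟩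
      minor u (0ℤ + M) (1ℤ + M) (j + M) (l + M)
        ≡⟨ minor-cong per 0ℤ 1ℤ j l ⟩
      minor u 0ℤ 1ℤ j l
        ≡⟨ sym (det-Y-Y j l 0ℤ) ⟩
      det (Y j) (Y l)
        ∎

  det-vec-positive : ∀ {a b} → a <ᵖ b → 0ℤ < det (vec a) (vec b)
  det-vec-positive (PP i<k) = det-chain-positive X (Y 0ℤ) consecutive left i<k
    where
    consecutive : ∀ k → 0ℤ < det (X k) (X (k + 1ℤ))
    consecutive k = subst (0ℤ <_) (sym (det-X-X+1 k)) (+<+ (s≤s z≤n))
    left : ∀ k → 0ℤ < det (X k) (Y 0ℤ)
    left k = subst (0ℤ <_) (sym (det-X-Y k 0ℤ)) (positive k 0ℤ)
  det-vec-positive (PQ {i} {j}) = subst (0ℤ <_) (sym (det-X-Y i j)) (positive i j)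
  det-vec-positive (QQ {j} {l} l<j) = subst (0ℤ <_) (det-swap (Y l) (Y j))
    (det-chain-positive (swap ∘ Y) (swap (X 0ℤ)) consecutive left l<j)
    where
    consecutive : ∀ k → 0ℤ < det (swap (Y k)) (swap (Y (k + 1ℤ)))
    consecutive k =
      subst (0ℤ <_) (sym (trans (det-swap (Y k) (Y (k + 1ℤ))) (det-Y+1-Y k))) (+<+ (s≤s z≤n))
    left : ∀ k → 0ℤ < det (swap (Y k)) (swap (X 0ℤ))
    left k = subst (0ℤ <_) (sym (trans (det-swap (Y k) (X 0ℤ)) (det-X-Y 0ℤ k))) (positive 0ℤ k)

  value : Pt → Pt → ℤ
  value a b = + ∣ det (vec a) (vec b) ∣

  value-sym : ∀ a b → value a b ≡ value b a
  value-sym a b = cong +_ (begin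
    ∣ det (vec a) (vec b) ∣    ≡⟨ sym (∣-i∣≡∣i∣ (det (vec a) (vec b))) ⟩
    ∣ - det (vec a) (vec b) ∣  ≡⟨ cong ∣_∣ (sym (det-antisym (vec a) (vec b))) ⟩
    ∣ det (vec b) (vec a) ∣    ∎)

  value-ordered : ∀ {a b} → a <ᵖ b → value a b ≡ det (vec a) (vec b)
  value-ordered a<b = 0≤i⇒+∣i∣≡i (<⇒≤ (det-vec-positive a<b))

  value-positive : ∀ a b → IsArc n a b → 0ℤ < value a b
  value-positive a b p with arc-ordered a b p
  ... | inj₁ a<b = subst (0ℤ <_) (sym (value-ordered a<b)) (det-vec-positive a<b)
  ... | inj₂ b<a =
    subst (0ℤ <_) (trans (sym (value-ordered b<a)) (value-sym b a)) (det-vec-positive b<a)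

  value-boundary : ∀ a b → IsBoundarySeg a b → value a b ≡ 1ℤ
  value-boundary (P i) (P k) seg with ∣k-i∣≡1⇒adjacent i k seg
  ... | inj₁ refl = cong (λ x → + ∣ x ∣) (det-X-X+1 i)
  ... | inj₂ refl = trans (value-sym (P (k + 1ℤ)) (P k)) (cong (λ x → + ∣ x ∣) (det-X-X+1 k))
  value-boundary (Q j) (Q l) seg with ∣k-i∣≡1⇒adjacent j l seg
  ... | inj₁ refl = cong (λ x → + ∣ x ∣) (det-Y-Y+1 j)
  ... | inj₂ refl = cong (λ x → + ∣ x ∣) (det-Y+1-Y l)

  value-ptolemy-sorted : ∀ {a b c d} → a <ᵖ b → b <ᵖ c → c <ᵖ d →
                         PtolemyAt value value-sym a b c d
  value-ptolemy-sorted {a} {b} {c} {d} a<b b<c c<d = begin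
    value a c * value b d
      ≡⟨ cong₂ _*_ (value-ordered a<c) (value-ordered b<d) ⟩
    det (vec a) (vec c) * det (vec b) (vec d)
      ≡⟨ plücker (vec a) (vec b) (vec c) (vec d) ⟩
    det (vec a) (vec b) * det (vec c) (vec d) + det (vec b) (vec c) * det (vec a) (vec d)
      ≡⟨ sym (cong₂ _+_ (cong₂ _*_ (value-ordered a<b) (value-ordered c<d))
                        (cong₂ _*_ (value-ordered b<c) (value-ordered a<d))) ⟩
    value a b * value c d + value b c * value a d
      ∎
    where
    a<c : a <ᵖ c
    a<c = <ᵖ-trans a<b b<c
    b<d : b <ᵖ d
    b<d = <ᵖ-trans b<c c<d
    a<d : a <ᵖ d
    a<d = <ᵖ-trans a<c c<d

  frieze : Frieze n
  frieze = record
    { F        = λ a b _ → value a b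
    ; positive = value-positive
    ; symm     = λ a b _ _ → value-sym a b
    ; deck     = λ K a b _ _ → cong (λ x → + ∣ x ∣)
                   (det-vec-shift (K * + n) (periodic-multiple (+ n) periodic K) a b)
    ; boundary = λ a b _ → value-boundary a b
    ; ptolemy  = λ A B C D quad _ _ _ _ _ _ →
                   ptolemy-quad value value-sym value-ptolemy-sorted quad
    }

  frieze-bridging : ∀ i j → toBiQF frieze i j ≡ u i j
  frieze-bridging i j = trans (value-ordered PQ) (det-X-Y i j)

theorem3p5 : (n : ℕ) → 1 ≤ n →
    -- the map lands in positive integral n-periodic BiQFs
    ((Fr : Frieze n) → IsPosIntPeriodicBiQF n (toBiQF Fr))
    -- injective
  × ((Fr Gr : Frieze n) → (∀ i j → toBiQF Fr i j ≡ toBiQF Gr i j) →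
       ∀ a b (p : IsArc n a b) → Frieze.F Fr a b p ≡ Frieze.F Gr a b p)
    -- surjective
  × ((u : ℤ → ℤ → ℤ) → IsPosIntPeriodicBiQF n u →
       ∃ λ (Fr : Frieze n) → ∀ i j → toBiQF Fr i j ≡ u i j)
theorem3p5 n 1≤n =
    (λ Fr → toBiQF-isPosIntPeriodicBiQF Fr 1≤n)
  , (λ Fr Gr same → frieze-determined 1≤n Fr Gr same)
  , (λ u H → frieze H , frieze-bridging H)
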